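{- Let $\mathbf{L}=(L,\sqsubseteq,\otimes,1,\Rightarrow_l,\Rightarrow_r,0,!,?)$ be an order-complete modal FL-algebra. Define $\mathcal{S}^{\mathbf{L}}=(S,\preceq,\lhd,\cdot,\varepsilon,0^{\mathbf{L}},I,R)$ by: $S=L$; $x\preceq y$ iff $y\sqsubseteq x$; $x\lhd C$ iff $x\sqsubseteq\bigsqcup C$; $x\cdot y=x\otimes y$; $\varepsilon=1$; $0^{\mathbf{L}}={\uparrow}0=\{x:x\sqsubseteq 0\}$; $I=\{!x:x\in L\}$; $R=\{(x,y):x\sqsubseteq ?y\}$. Then $\mathcal{S}^{\mathbf{L}}$ is a modal FL-cover system in which, for all $x\in L$, $${\uparrow}(!x)=j{\uparrow}(({\uparrow}x)\cap I)\quad\text{and}\quad {\uparrow}(?x)=\langle R\rangle({\uparrow}x),$$ where ${\uparrow}$ is computed with respect to $\preceq$ (so ${\uparrow}x=\{y:y\sqsubseteq x\}$).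
   Context: Modal FL-algebras. A residuated lattice is $(L,\sqsubseteq,\otimes,1,\Rightarrow_l,\Rightarrow_r)$ with $(L,\sqsubseteq)$ a lattice, $(L,\otimes,1)$ a monoid with $\otimes$ monotone, and $a\sqsubseteq b\Rightarrow_l c$ iff $a\otimes b\sqsubseteq c$ iff $b\sqsubseteq a\Rightarrow_r c$. An FL-algebra is a residuated lattice with a distinguished element $0$. A modal FL-algebra is a bounded FL-algebra with unary operations $!,?$ such that for all $a,b$: (s1) $!a\sqsubseteq a$; (s2) $!a\sqsubseteq !!a$; (s3) $!1=1$; (s4) $!(a\sqcap b)=!a\otimes !b$; (s5) $!a\otimes b=b\otimes !a$; (c1) $!(a\Rightarrow_i b)\sqsubseteq ?a\Rightarrow_i ?b$ for $i=l,r$; (c2) $a\sqsubseteq ?a$; (c3) $??a\sqsubseteq ?a$; (c4) $?0\sqsubseteq 0$; (c5) $0\sqsubseteq ?a$. Order-complete means every subset has a join $\bigsqcup$ (and meet). Cover systems. A structure $(S,\preceq,\lhd)$ consists of a set $S$, a preorder $\preceq$, and $\lhd\subseteq S\times\mathcal{P}(S)$. For $X\subseteq S$, ${\uparrow}X=\{y:\exists x\in X,\ x\preceq y\}$, ${\uparrow}x={\uparrow}\{x\}$; up-sets satisfy ${\uparrow}X=X$. It is a cover system if: (Existence) each $x$ has a cover $C\subseteq{\uparrow}x$; (Transitivity) $x\lhd C$ and $y\lhd C_y$ for all $y\in C$ imply $x\lhd\bigcup_{y\in C}C_y$; (Refinement) $x\preceq y$ and $x\lhd C$ imply some $C'\subseteq{\uparrow}C$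 with $y\lhd C'$. $jX=\{x:\exists C\,(x\lhd C\subseteq X)\}$; a proposition is an up-set $X$ with $jX\subseteq X$; $\mathit{Prop}(\mathcal{S})$ is the set of propositions. $\langle R\rangle X=\{x:\exists y\,(xRy,\ y\in X)\}$. For $X,Y\subseteq S$, $X\cdot Y=\{x\cdot y:x\in X,y\in Y\}$, $x\cdot Y=\{x\}\cdot Y$. A residuated cover system $(S,\preceq,\lhd,\cdot,\varepsilon)$ is a cover system with an associative $\preceq$-monotone operation $\cdot$ with identity $\varepsilon$ such that $x\lhd C$ implies $x\cdot y\lhd C\cdot y$ and $y\cdot x\lhd y\cdot C$, and $x\lhd C\subseteq{\uparrow}\varepsilon$ implies $\varepsilon\preceq x$. A modal FL-cover system $(S,\preceq,\lhd,\cdot,\varepsilon,0,I,R)$ has $0\in\mathit{Prop}(\mathcal{S})$, $I\subseteq{\uparrow}\varepsilon$, $R\subseteq S\times S$, with: $(S,\preceq,\lhd,\cdot,\varepsilon)$ a residuated cover system; $I$ closed under $\cdot$ and $\varepsilon\in I$; $\varepsilon\lhd I$; each $x\in I$ has $x=x\cdot x$ and $x\cdot y=y\cdot x$ for all $y$; if $x\preceq y$ and $xRz$ then some $w$ has $z\preceq w$ and $yRw$; if some $x$-cover is included in $\langle R\rangle X$ then some $y$ has $xRy$ and a $y$-cover included in $X$; $x\in I$ and $yRz$ imply $(x\cdot y)R(x\cdot z)$ and $(y\cdot x)R(z\cdot x)$; $R$ reflexive and transitive; $xRy\in 0$ implies $x\in0$; $x\in 0$ implies some $y$ with $xRy$ and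 $y\lhd\emptyset$. -}

module Defs where

open import Level using (Level; Lift; suc)
import Level
open import Data.Empty using (⊥)
open import Data.Product using (Σ; ∃; ∃-syntax; _×_; _,_)
open import Relation.Binary.PropositionalEquality using (_≡_)
open import Relation.Unary using (Pred; _⊆_; _∩_)

_≐_ : ∀ {a ℓ₁ ℓ₂} {S : Set a} → Pred S ℓ₁ → Pred S ℓ₂ → Set (a Level.⊔ ℓ₁ Level.⊔ ℓ₂)
X ≐ Y = (X ⊆ Y) × (Y ⊆ X)

∅ℓ : ∀ {ℓ} {S : Set ℓ} → Pred S ℓ
∅ℓ {ℓ} _ = Lift ℓ ⊥

｛_｝ : ∀ {ℓ} {S : Set ℓ} → S → Pred S ℓ
｛ x ｝ y = x ≡ y

record ModalFLAlgebra (ℓ : Level) : Set (suc ℓ) where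
  infix  4 _⊑_
  infixr 7 _⊗_
  field
    Carrier : Set ℓ
    _⊑_     : Carrier → Carrier → Set ℓ
    ⊑-refl    : ∀ {a} → a ⊑ a
    ⊑-trans   : ∀ {a b c} → a ⊑ b → b ⊑ c → a ⊑ c
    ⊑-antisym : ∀ {a b} → a ⊑ b → b ⊑ a → a ≡ b
    _⊓_ _⊔_ : Carrier → Carrier → Carrier
    ⊓-lb₁ : ∀ a b → a ⊓ b ⊑ a
    ⊓-lb₂ : ∀ a b → a ⊓ b ⊑ b
    ⊓-glb : ∀ {a b c} → c ⊑ a → c ⊑ b → c ⊑ a ⊓ b
    ⊔-ub₁ : ∀ a b → a ⊑ a ⊔ b
    ⊔-ub₂ : ∀ a b → b ⊑ a ⊔ b
    ⊔-lub : ∀ {a b c} → a ⊑ c → b ⊑ c → a ⊔ b ⊑ c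
    top bot : Carrier
    top-max : ∀ a → a ⊑ top
    bot-min : ∀ a → bot ⊑ a
    _⊗_ : Carrier → Carrier → Carrier
    𝟏   : Carrier
    ⊗-assoc : ∀ a b c → (a ⊗ b) ⊗ c ≡ a ⊗ (b ⊗ c)
    ⊗-idˡ   : ∀ a → 𝟏 ⊗ a ≡ a
    ⊗-idʳ   : ∀ a → a ⊗ 𝟏 ≡ a
    ⊗-mono  : ∀ {a a' b b'} → a ⊑ a' → b ⊑ b' → a ⊗ b ⊑ a' ⊗ b'
    _⇒l_ _⇒r_ : Carrier → Carrier → Carrier
    resˡ-to   : ∀ {a b c} → a ⊑ b ⇒l c → a ⊗ b ⊑ c
    resˡ-from : ∀ {a b c} → a ⊗ b ⊑ c → a ⊑ b ⇒l c
    resʳ-to   : ∀ {a b c} → b ⊑ a ⇒r c → a ⊗ b ⊑ c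
    resʳ-from : ∀ {a b c} → a ⊗ b ⊑ c → b ⊑ a ⇒r c
    𝟎 : Carrier
    ! ¿ : Carrier → Carrier
    s1 : ∀ a → ! a ⊑ a
    s2 : ∀ a → ! a ⊑ ! (! a)
    s3 : ! 𝟏 ≡ 𝟏
    s4 : ∀ a b → ! (a ⊓ b) ≡ ! a ⊗ ! b
    s5 : ∀ a b → ! a ⊗ b ≡ b ⊗ ! a
    c1l : ∀ a b → ! (a ⇒l b) ⊑ ¿ a ⇒l ¿ b
    c1r : ∀ a b → ! (a ⇒r b) ⊑ ¿ a ⇒r ¿ b
    c2 : ∀ a → a ⊑ ¿ a
    c3 : ∀ a → ¿ (¿ a) ⊑ ¿ a
    c4 : ¿ 𝟎 ⊑ 𝟎
    c5 : ∀ a → 𝟎 ⊑ ¿ a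

record OrderComplete {ℓ} (L : ModalFLAlgebra ℓ) : Set (suc ℓ) where
  open ModalFLAlgebra L
  field
    ⨆ : Pred Carrier ℓ → Carrier
    ⨆-ub  : ∀ (X : Pred Carrier ℓ) {a} → X a → a ⊑ ⨆ X
    ⨆-lub : ∀ (X : Pred Carrier ℓ) {b} → (∀ {a} → X a → a ⊑ b) → ⨆ X ⊑ b
    ⨅ : Pred Carrier ℓ → Carrier
    ⨅-lb  : ∀ (X : Pred Carrier ℓ) {a} → X a → ⨅ X ⊑ a
    ⨅-glb : ∀ (X : Pred Carrier ℓ) {b} → (∀ {a} → X a → b ⊑ a) → b ⊑ ⨅ X

module CoverNotions {ℓ} {S : Set ℓ} (_⪯_ : S → S → Set ℓ)
                    (_◁_ : S → Pred S ℓ → Set ℓ) where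

  ↑ : Pred S ℓ → Pred S ℓ
  ↑ X y = ∃[ x ] (X x × x ⪯ y)

  ↑ₛ : S → Pred S ℓ
  ↑ₛ x = ↑ ｛ x ｝

  IsUpSet : Pred S ℓ → Set ℓ
  IsUpSet X = ↑ X ⊆ X

  j : Pred S ℓ → Pred S (suc ℓ)
  j X x = ∃[ C ] (x ◁ C × C ⊆ X)

  IsProp : Pred S ℓ → Set (suc ℓ)
  IsProp X = IsUpSet X × (j X ⊆ X)

  ⟨_⟩ : (S → S → Set ℓ) → Pred S ℓ → Pred S ℓ
  ⟨ R ⟩ X x = ∃[ y ] (R x y × X y)

  record IsCoverSystem : Set (suc ℓ) where
    field
      ⪯-refl  : ∀ {x} → x ⪯ x
      ⪯-trans : ∀ {x y z} → x ⪯ y → y ⪯ z → x ⪯ z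
      existence : ∀ x → ∃[ C ] (x ◁ C × C ⊆ ↑ₛ x)
      transitivity : ∀ {x} {C : Pred S ℓ} (Cy : (y : S) → C y → Pred S ℓ) →
        x ◁ C → (∀ y (p : C y) → y ◁ Cy y p) →
        x ◁ (λ z → ∃[ y ] Σ (C y) (λ p → Cy y p z))
      refinement : ∀ {x y} {C : Pred S ℓ} → x ⪯ y → x ◁ C →
        ∃[ C' ] (C' ⊆ ↑ C × y ◁ C')

module ResNotions {ℓ} {S : Set ℓ} (_·_ : S → S → S) where
  _⋆_ : Pred S ℓ → Pred S ℓ → Pred S ℓ
  (X ⋆ Y) z = ∃[ x ] ∃[ y ] (X x × Y y × z ≡ x · y)

record IsModalFLCoverSystem {ℓ} (S : Set ℓ) (_⪯_ : S → S → Set ℓ)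
    (_◁_ : S → Pred S ℓ → Set ℓ) (_·_ : S → S → S) (ε : S)
    (Z : Pred S ℓ) (I : Pred S ℓ) (R : S → S → Set ℓ) : Set (suc ℓ) where
  open CoverNotions _⪯_ _◁_
  open ResNotions _·_
  field
    isCoverSystem : IsCoverSystem
    ·-assoc : ∀ x y z → (x · y) · z ≡ x · (y · z)
    ·-mono  : ∀ {x x' y y'} → x ⪯ x' → y ⪯ y' → (x · y) ⪯ (x' · y')
    ·-idˡ   : ∀ x → ε · x ≡ x
    ·-idʳ   : ∀ x → x · ε ≡ x
    ◁-·ʳ : ∀ {x y} {C : Pred S ℓ} → x ◁ C → (x · y) ◁ (C ⋆ ｛ y ｝)
    ◁-·ˡ : ∀ {x y} {C : Pred S ℓ} → x ◁ C → (y · x) ◁ (｛ y ｝ ⋆ C)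
    ◁-ε  : ∀ {x} {C : Pred S ℓ} → x ◁ C → C ⊆ ↑ₛ ε → ε ⪯ x
    Z-prop   : IsProp Z
    I⊆↑ε     : I ⊆ ↑ₛ ε
    I-closed : ∀ {x y} → I x → I y → I (x · y)
    ε∈I      : I ε
    ε◁I      : ε ◁ I
    I-idem   : ∀ {x} → I x → x ≡ x · x
    I-comm   : ∀ {x} → I x → ∀ y → x · y ≡ y · x
    R-⪯      : ∀ {x y z} → x ⪯ y → R x z → ∃[ w ] (z ⪯ w × R y w)
    R-cover  : ∀ {x} (X : Pred S ℓ) → (∃[ C ] (x ◁ C × C ⊆ ⟨ R ⟩ X)) →
               ∃[ y ] (R x y × ∃[ C' ] (y ◁ C' × C' ⊆ X))
    R-Iˡ     : ∀ {x y z} → I x → R y z → R (x · y) (x · z)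
    R-Iʳ     : ∀ {x y z} → I x → R y z → R (y · x) (z · x)
    R-refl   : ∀ {x} → R x x
    R-trans  : ∀ {x y z} → R x y → R y z → R x z
    R-Z      : ∀ {x y} → R x y → Z y → Z x
    Z-R      : ∀ {x} → Z x → ∃[ y ] (R x y × y ◁ ∅ℓ)

module SL {ℓ} (L : ModalFLAlgebra ℓ) (oc : OrderComplete L) where
  open ModalFLAlgebra L
  open OrderComplete oc

  S : Set ℓ
  S = Carrier

  _⪯_ : S → S → Set ℓ
  x ⪯ y = y ⊑ x

  _◁_ : S → Pred S ℓ → Set ℓ
  x ◁ C = x ⊑ ⨆ C

  _·_ : S → S → S
  x · y = x ⊗ y

  ε : S
  ε = 𝟏

  Zᴸ : Pred S ℓ
  Zᴸ x = x ⊑ 𝟎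

  I : Pred S ℓ
  I y = ∃[ x ] (y ≡ ! x)

  R : S → S → Set ℓ
  R x y = x ⊑ ¿ y

module Submission where

open import Defs
open import Level using (Level)
open import Data.Product using (_×_; _,_; ∃-syntax)
open import Relation.Unary using (Pred; _⊆_; _∩_)
open import Relation.Binary.PropositionalEquality
  using (_≡_; refl; sym; trans; cong; subst)

module ModalFLAlgebraProperties {ℓ : Level} (L : ModalFLAlgebra ℓ) where
  open ModalFLAlgebra L

  ≡⇒⊑ : ∀ {a b} → a ≡ b → a ⊑ b
  ≡⇒⊑ refl = ⊑-refl

  ⊓-idem : ∀ a → a ⊓ a ≡ a
  ⊓-idem a = ⊑-antisym (⊓-lb₁ a a) (⊓-glb ⊑-refl ⊑-refl)

  -- Every !-element lies below the unit: !a = !(a ⊓ 𝟏) ⊑ a ⊓ 𝟏 ⊑ 𝟏 by (s3), (s4).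
  !⊑𝟏 : ∀ a → ! a ⊑ 𝟏
  !⊑𝟏 a = subst (_⊑ 𝟏) !a⊓𝟏≡!a (⊑-trans (s1 (a ⊓ 𝟏)) (⊓-lb₂ a 𝟏))
    where
    !a⊓𝟏≡!a : ! (a ⊓ 𝟏) ≡ ! a
    !a⊓𝟏≡!a = trans (s4 a 𝟏) (trans (cong (! a ⊗_) s3) (⊗-idʳ (! a)))

  -- ! is monotone: if a ⊑ b then !a = !(a ⊓ b) = !a ⊗ !b ⊑ 𝟏 ⊗ !b = !b.
  !-mono : ∀ {a b} → a ⊑ b → ! a ⊑ ! b
  !-mono {a} {b} a⊑b =
    ⊑-trans (≡⇒⊑ (cong ! a≡a⊓b))
      (⊑-trans (≡⇒⊑ (s4 a b))
        (⊑-trans (⊗-mono (!⊑𝟏 a) ⊑-refl) (≡⇒⊑ (⊗-idˡ (! b)))))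
    where
    a≡a⊓b : a ≡ a ⊓ b
    a≡a⊓b = ⊑-antisym (⊓-glb ⊑-refl a⊑b) (⊓-lb₁ a b)

  -- ¿ is monotone: a ⊑ b gives 𝟏 ⊑ a ⇒l b, hence 𝟏 = !𝟏 ⊑ !(a ⇒l b) ⊑ ¿a ⇒l ¿b by (c1).
  ¿-mono : ∀ {a b} → a ⊑ b → ¿ a ⊑ ¿ b
  ¿-mono {a} {b} a⊑b = ⊑-trans (≡⇒⊑ (sym (⊗-idˡ (¿ a)))) (resˡ-to 𝟏⊑¿a⇒¿b)
    where
    𝟏⊑a⇒b : 𝟏 ⊑ a ⇒l b
    𝟏⊑a⇒b = resˡ-from (⊑-trans (≡⇒⊑ (⊗-idˡ a)) a⊑b)
    𝟏⊑¿a⇒¿b : 𝟏 ⊑ ¿ a ⇒l ¿ b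
    𝟏⊑¿a⇒¿b = ⊑-trans (≡⇒⊑ (sym s3)) (⊑-trans (!-mono 𝟏⊑a⇒b) (c1l a b))

  -- !-elements are ⊗-idempotent: !a = !(a ⊓ a) = !a ⊗ !a.
  !-⊗-idem : ∀ a → ! a ≡ ! a ⊗ ! a
  !-⊗-idem a = trans (cong ! (sym (⊓-idem a))) (s4 a a)

  -- A !-element below x is below !x: !a ⊑ !!a ⊑ !x.
  !-below⇒below-! : ∀ {a x} → ! a ⊑ x → ! a ⊑ ! x
  !-below⇒below-! {a} !a⊑x = ⊑-trans (s2 a) (!-mono !a⊑x)

  ¿-closure : ∀ {a b} → a ⊑ ¿ b → ¿ a ⊑ ¿ b
  ¿-closure a⊑¿b = ⊑-trans (¿-mono a⊑¿b) (c3 _)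

  -- Promotion on the left: !a ⊑ !!a ⊑ !(z ⇒l (!a ⊗ z)) ⊑ ¿z ⇒l ¿(!a ⊗ z).
  promoteˡ : ∀ a {y z} → y ⊑ ¿ z → ! a ⊗ y ⊑ ¿ (! a ⊗ z)
  promoteˡ a {y} {z} y⊑¿z = ⊑-trans (⊗-mono !a⊑ y⊑¿z) (resˡ-to (c1l z (! a ⊗ z)))
    where
    !a⊑ : ! a ⊑ ! (z ⇒l (! a ⊗ z))
    !a⊑ = ⊑-trans (s2 a) (!-mono (resˡ-from ⊑-refl))

  promoteʳ : ∀ a {y z} → y ⊑ ¿ z → y ⊗ ! a ⊑ ¿ (z ⊗ ! a)
  promoteʳ a {y} {z} y⊑¿z = ⊑-trans (⊗-mono y⊑¿z !a⊑) (resʳ-to (c1r z (z ⊗ ! a)))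
    where
    !a⊑ : ! a ⊑ ! (z ⇒r (z ⊗ ! a))
    !a⊑ = ⊑-trans (s2 a) (!-mono (resʳ-from ⊑-refl))

module CompleteJoinProperties {ℓ : Level} (L : ModalFLAlgebra ℓ) (oc : OrderComplete L) where
  open ModalFLAlgebra L
  open OrderComplete oc
  open ResNotions _⊗_

  below-⨆-bounded : ∀ {x b} (C : Pred Carrier ℓ) →
                    x ⊑ ⨆ C → (∀ {c} → C c → c ⊑ b) → x ⊑ b
  below-⨆-bounded C x⊑⨆C bound = ⊑-trans x⊑⨆C (⨆-lub C bound)

  -- (⨆ C) ⊗ y ⊑ ⨆ (C · {y}), since (_⊗ y) is a left adjoint.
  ⨆-⊗ʳ : ∀ (C : Pred Carrier ℓ) y → ⨆ C ⊗ y ⊑ ⨆ (C ⋆ ｛ y ｝)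
  ⨆-⊗ʳ C y = resˡ-to (⨆-lub C λ {c} c∈C →
    resˡ-from (⨆-ub (C ⋆ ｛ y ｝) (c , y , c∈C , refl , refl)))

  -- y ⊗ (⨆ C) ⊑ ⨆ ({y} · C), since (y ⊗_) is a left adjoint.
  ⨆-⊗ˡ : ∀ (C : Pred Carrier ℓ) y → y ⊗ ⨆ C ⊑ ⨆ (｛ y ｝ ⋆ C)
  ⨆-⊗ˡ C y = resʳ-to (⨆-lub C λ {c} c∈C →
    resʳ-from (⨆-ub (｛ y ｝ ⋆ C) (y , c , refl , c∈C , refl)))

module CoverSystemOfAlgebra {ℓ : Level} (L : ModalFLAlgebra ℓ) (oc : OrderComplete L) where
  open ModalFLAlgebra L
  open OrderComplete oc
  open SL L oc
  open CoverNotions _⪯_ _◁_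
  open ModalFLAlgebraProperties L
  open CompleteJoinProperties L oc

  -- With the reversed order, the principal up-set of x is the down-set of x in L.
  ↑ₛ-intro : ∀ {x y} → y ⊑ x → ↑ₛ x y
  ↑ₛ-intro {x} y⊑x = x , refl , y⊑x

  ↑ₛ-elim : ∀ {x y} → ↑ₛ x y → y ⊑ x
  ↑ₛ-elim (_ , refl , y⊑x) = y⊑x

  -- Covers are joins, so the cover axioms are properties of ⨆:
  -- x ◁ {x}; transitivity is ⨆ C ⊑ ⨆ ⋃ Cy; refinement keeps the same cover.
  isCoverSystem : IsCoverSystem
  isCoverSystem = record
    { ⪯-refl       = ⊑-refl
    ; ⪯-trans      = λ x⪯y y⪯z → ⊑-trans y⪯z x⪯y
    ; existence    = λ x → ｛ x ｝ , ⨆-ub ｛ x ｝ refl , λ { refl → ↑ₛ-intro ⊑-refl }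
    ; transitivity = λ {x} {C} Cy x◁C c◁Cy → below-⨆-bounded C x◁C λ {c} c∈C →
                       below-⨆-bounded (Cy c c∈C) (c◁Cy c c∈C) λ z∈Cy →
                         ⨆-ub _ (c , c∈C , z∈Cy)
    ; refinement   = λ {_} {_} {C} y⊑x x◁C →
                       C , (λ {c} c∈C → c , c∈C , ⊑-refl) , ⊑-trans y⊑x x◁C
    }

  -- Z = ↑0 is a proposition: it is a down-set in L closed under joins of covers.
  Zᴸ-prop : IsProp Zᴸ
  Zᴸ-prop = (λ { (_ , x⊑0 , y⊑x) → ⊑-trans y⊑x x⊑0 })
          , (λ { (C , x◁C , C⊆Z) → below-⨆-bounded C x◁C C⊆Z })

  -- A cover of x inside ⟨R⟩X is bounded by ¿(⨆ X), so ⨆ X is an R-successor of x,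
  -- and X itself covers ⨆ X.
  R-cover : ∀ {x} (X : Pred S ℓ) → ∃[ C ] (x ◁ C × C ⊆ ⟨ R ⟩ X) →
            ∃[ y ] (R x y × ∃[ C' ] (y ◁ C' × C' ⊆ X))
  R-cover X (C , x◁C , C⊆⟨R⟩X) =
      ⨆ X
    , below-⨆-bounded C x◁C (λ c∈C → bounded (C⊆⟨R⟩X c∈C))
    , X , ⊑-refl , (λ y∈X → y∈X)
    where
    bounded : ∀ {c} → ⟨ R ⟩ X c → c ⊑ ¿ (⨆ X)
    bounded (_ , c⊑¿y , y∈X) = ⊑-trans c⊑¿y (¿-mono (⨆-ub X y∈X))

  -- Each axiom is an algebraic fact: ◁ is stable under ⊗ because ⊗ preserves joins,
  -- I consists of !-elements ((s3)–(s5), !a ⊑ 𝟏), R-compatibility with I is promotion,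
  -- R is reflexive/transitive by (c2)/(c3), and Z interacts with R via (c4)/(c5)
  -- (the witness for Z-R is ⨆ ∅, which the empty cover covers).
  isModalFLCoverSystem : IsModalFLCoverSystem S _⪯_ _◁_ _·_ ε Zᴸ I R
  isModalFLCoverSystem = record
    { isCoverSystem = isCoverSystem
    ; ·-assoc  = ⊗-assoc
    ; ·-mono   = ⊗-mono
    ; ·-idˡ    = ⊗-idˡ
    ; ·-idʳ    = ⊗-idʳ
    ; ◁-·ʳ     = λ {_} {y} {C} x◁C → ⊑-trans (⊗-mono x◁C ⊑-refl) (⨆-⊗ʳ C y)
    ; ◁-·ˡ     = λ {_} {y} {C} x◁C → ⊑-trans (⊗-mono ⊑-refl x◁C) (⨆-⊗ˡ C y)
    ; ◁-ε      = λ {_} {C} x◁C C⊆↑ε → below-⨆-bounded C x◁C (λ c∈C → ↑ₛ-elim (C⊆↑ε c∈C))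
    ; Z-prop   = Zᴸ-prop
    ; I⊆↑ε     = λ { (a , refl) → ↑ₛ-intro (!⊑𝟏 a) }
    ; I-closed = λ { (a , refl) (b , refl) → a ⊓ b , sym (s4 a b) }
    ; ε∈I      = 𝟏 , sym s3
    ; ε◁I      = ⨆-ub I (𝟏 , sym s3)
    ; I-idem   = λ { (a , refl) → !-⊗-idem a }
    ; I-comm   = λ { (a , refl) y → s5 a y }
    ; R-⪯      = λ {_} {_} {z} y⊑x x⊑¿z → z , ⊑-refl , ⊑-trans y⊑x x⊑¿z
    ; R-cover  = R-cover
    ; R-Iˡ     = λ { (a , refl) y⊑¿z → promoteˡ a y⊑¿z }
    ; R-Iʳ     = λ { (a , refl) y⊑¿z → promoteʳ a y⊑¿z }
    ; R-refl   = c2 _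
    ; R-trans  = λ x⊑¿y y⊑¿z → ⊑-trans x⊑¿y (¿-closure y⊑¿z)
    ; R-Z      = λ x⊑¿y y⊑0 → ⊑-trans x⊑¿y (⊑-trans (¿-mono y⊑0) c4)
    ; Z-R      = λ x⊑0 → ⨆ ∅ℓ , ⊑-trans x⊑0 (c5 _) , ⊑-refl
    }

  -- ↑(!x) is generated by the !-elements below x: !x itself is one, and every
  -- !-element !a ⊑ x lies below !x, so a cover by elements under them stays below !x.
  ↑!-characterisation : ∀ x → ↑ₛ (! x) ≐ j (↑ (↑ₛ x ∩ I))
  ↑!-characterisation x = ⊆-direction , ⊇-direction
    where
    -- !x ∈ ↑x ∩ I, so everything below !x lies in ↑(↑x ∩ I).
    !x-generator : ∀ {y} → y ⊑ ! x → ↑ (↑ₛ x ∩ I) y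
    !x-generator y⊑!x = ! x , (↑ₛ-intro (s1 x) , (x , refl)) , y⊑!x

    ⊆-direction : ↑ₛ (! x) ⊆ j (↑ (↑ₛ x ∩ I))
    ⊆-direction {y} y⊑!x =
      ｛ y ｝ , ⨆-ub ｛ y ｝ refl , λ { refl → !x-generator (↑ₛ-elim y⊑!x) }

    generators-below-!x : ∀ {c} → ↑ (↑ₛ x ∩ I) c → c ⊑ ! x
    generators-below-!x (_ , (w⊑x , (a , refl)) , c⊑!a) = ⊑-trans c⊑!a (!-below⇒below-! (↑ₛ-elim w⊑x))

    ⊇-direction : j (↑ (↑ₛ x ∩ I)) ⊆ ↑ₛ (! x)
    ⊇-direction (C , y◁C , C⊆) = ↑ₛ-intro (below-⨆-bounded C y◁C (λ c∈C → generators-below-!x (C⊆ c∈C)))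

  -- ↑(¿x) is the R-preimage of ↑x: y ⊑ ¿x witnesses y R x, and y ⊑ ¿w with w ⊑ x gives y ⊑ ¿x.
  ↑¿-characterisation : ∀ x → ↑ₛ (¿ x) ≐ ⟨ R ⟩ (↑ₛ x)
  ↑¿-characterisation x =
      (λ y⊑¿x → x , ↑ₛ-elim y⊑¿x , ↑ₛ-intro ⊑-refl)
    , (λ { (w , y⊑¿w , w⊑x) → ↑ₛ-intro (⊑-trans y⊑¿w (¿-mono (↑ₛ-elim w⊑x))) })

lemma4 : ∀ {ℓ : Level} (L : ModalFLAlgebra ℓ) (oc : OrderComplete L) →
    let open ModalFLAlgebra L
        open SL L oc
        open CoverNotions _⪯_ _◁_
    in IsModalFLCoverSystem S _⪯_ _◁_ _·_ ε Zᴸ I R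
       × (∀ x → ↑ₛ (! x) ≐ j (↑ (↑ₛ x ∩ I)))
       × (∀ x → ↑ₛ (¿ x) ≐ ⟨ R ⟩ (↑ₛ x))
lemma4 L oc =
    isModalFLCoverSystem
  , ↑!-characterisation
  , ↑¿-characterisation
  where open CoverSystemOfAlgebra L oc
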